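{- Let $k\ge1$, $n=2k$, and let $s=x_1\cdots x_{2k-1}$ be a win-loss sequence for a unicard game with exactly $k$ letters $L$ and $k-1$ letters $W$. Let $T$ be the bottom tree of $s$ defined below, with $k$ vertices. Then the number of unicard initial states $a_1\,|\,a_2\cdots a_{2k}$ (assignments of the values $1,\dots,2k$) from which War played with random putback necessarily follows $s$ is $$\frac{(k!)^2}{\prod_{v\in T}h(v)},$$ where $h(v)$ is the number of vertices of $T$ less than or equal to $v$, i.e. the number of vertices in the subtree of $T$ rooted at $v$ (including $v$).
   Context: War: $n$ cards with distinct values $1,\dots,n$; in the state $a_1\,|\,a_2\cdots a_n$ Alice holds only $a_1$ and Bob holds $a_2,\dots,a_n$ top to bottom. In a round both reveal their top card and the owner of the higher card puts both at the bottom of their hand, in a uniformly random order (random putback). A player with no cards loses. A win-loss sequence for a unicard game is a string $x_1\cdots x_R$ over $\{W,L\}$ such that $1+w_i-\ell_i>0$ for $i<R$ and $1+w_R-\ell_R=0$, where $w_i,\ell_i$ count $W$'s and $L$'s among the first $i$ letters. An initial state necessarily follows $s$ if for every possible sequence of putback choices, Alice wins round $i$ exactly when $x_i=W$ (for all $i$) and the game ends after round $2k-1$; in such a game Bob plays card $a_{i+1}$ in round $i$. Win-loss binary tree of $s$: the unique full binary tree whose nodes, read level by level from the root and left to right within each level, are rounds $1,2,\dots,2k-1$ in order, where round $i$ is an internal node (with two children) if $x_i=W$ and a leaf if $x_i=L$. Bottom tree $T$: vertex set $\{a_1\}\cup\{a_{i+1}: x_i=W\}$, rooted at $a_1$; if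 $x_1=W$ then $a_2$ is the child of $a_1$, and for $W$ rounds $i,j$ with round $j$ a child of round $i$ in the win-loss binary tree, $a_{j+1}$ is a child of $a_{i+1}$. -}

module Defs where

open import Data.Nat using (ℕ; zero; suc; _+_; _*_; _<ᵇ_)
open import Data.Bool using (Bool; true; false; if_then_else_)
open import Data.Integer as ℤ using (ℤ; +_; -[1+_])
open import Data.List using (List; []; _∷_; _++_; concat; length; applyUpTo)
open import Data.Vec using (Vec; []; _∷_)
open import Data.Product using (_×_)
open import Data.Sum using (_⊎_)
open import Data.Empty using (⊥)
open import Relation.Binary.PropositionalEquality using (_≡_)
open import Data.List.Relation.Binary.Permutation.Propositional using (_↭_)

data Letter : Set where
  W L : Letter

-- change in Alice's card count caused by a round
δ : Letter → ℤ
δ W = + 1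
δ L = -[1+ 0 ]

-- GoodFrom c s : with Alice currently holding c cards (as an integer
-- 1 + w_i - ℓ_i), the rest s keeps the count positive until its last
-- letter, after which the count is exactly 0.  R ≥ 1 is required.
GoodFrom : ℤ → List Letter → Set
GoodFrom c [] = ⊥
GoodFrom c (x ∷ []) = c ℤ.+ δ x ≡ + 0
GoodFrom c (x ∷ y ∷ xs) = (+ 0 ℤ.< c ℤ.+ δ x) × GoodFrom (c ℤ.+ δ x) (y ∷ xs)

IsWinLossSequence : List Letter → Set
IsWinLossSequence s = GoodFrom (+ 1) s

occ : Letter → List Letter → ℕ
occ l [] = 0
occ W (W ∷ xs) = suc (occ W xs)
occ W (L ∷ xs) = occ W xs
occ L (L ∷ xs) = suc (occ L xs)
occ L (W ∷ xs) = occ L xs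

-- result of a round for Alice, given Alice's card a and Bob's card b
-- (cards are distinct, so no ties occur in the games considered)
outcome : ℕ → ℕ → Letter
outcome a b = if b <ᵇ a then W else L

-- the winner puts the two cards (own card p, opponent's card q) at the
-- bottom in the order determined by the choice bit
putback : Bool → ℕ → ℕ → List ℕ
putback true  p q = p ∷ q ∷ []
putback false p q = q ∷ p ∷ []

-- Follows s cs A B : starting from Alice's hand A and Bob's hand B
-- (top first), and using the putback choices cs, the game has Alice win
-- round i exactly when x_i = W, no player runs out of cards before a
-- round is played, and the game is over (a hand is empty) after the
-- last round of s.
Follows : (s : List Letter) → Vec Bool (length s) → List ℕ → List ℕ → Set
Follows [] [] A B = (A ≡ []) ⊎ (B ≡ [])
Follows (x ∷ s) (c ∷ cs) [] B = ⊥
Follows (x ∷ s) (c ∷ cs) (a ∷ A) [] = ⊥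
Follows (x ∷ s) (c ∷ cs) (a ∷ A) (b ∷ B) with b <ᵇ a
... | true  = (outcome a b ≡ x) × Follows s cs (A ++ putback c a b) B
... | false = (outcome a b ≡ x) × Follows s cs A (B ++ putback c b a)

-- The unicard initial state a_1 | a_2 ... a_n, written as the list
-- a_1 ∷ a_2 ∷ ... ∷ a_n, necessarily follows s: for every sequence of
-- putback choices the game follows s.
NecessarilyFollows : List Letter → List ℕ → Set
NecessarilyFollows s [] = ⊥
NecessarilyFollows s (a ∷ rest) =
  (cs : Vec Bool (length s)) → Follows s cs (a ∷ []) rest

IsInitialState : ℕ → List ℕ → Set
IsInitialState n xs = xs ↭ applyUpTo suc n

data BTree : Set where
  leaf : BTree
  node : BTree → BTree → BTree

mergeLevels : List (List Letter) → List (List Letter) → List (List Letter)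
mergeLevels [] ys = ys
mergeLevels (x ∷ xs) [] = x ∷ xs
mergeLevels (x ∷ xs) (y ∷ ys) = (x ++ y) ∷ mergeLevels xs ys

levels : BTree → List (List Letter)
levels leaf = (L ∷ []) ∷ []
levels (node l r) = (W ∷ []) ∷ mergeLevels (levels l) (levels r)

levelOrder : BTree → List Letter
levelOrder t = concat (levels t)

-- Bottom tree (rooted, unordered shape suffices for hook lengths)

data Tree : Set where
  vertex : List Tree → Tree

-- the W-rounds of a win-loss binary tree, with the induced parent relation
wNodes : BTree → List Tree
wNodes leaf = []
wNodes (node l r) = vertex (wNodes l ++ wNodes r) ∷ []

-- bottom tree: root a_1, whose child (if x_1 = W) is a_2 (round 1), and
-- below it the W-rounds arranged as in the win-loss binary tree
bottomTree : BTree → Tree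
bottomTree t = vertex (wNodes t)

mutual
  size : Tree → ℕ
  size (vertex ts) = suc (sizes ts)

  sizes : List Tree → ℕ
  sizes [] = 0
  sizes (t ∷ ts) = size t + sizes ts

mutual
  hookProduct : Tree → ℕ
  hookProduct (vertex ts) = size (vertex ts) * hookProducts ts

  hookProducts : List Tree → ℕ
  hookProducts [] = 1
  hookProducts (t ∷ ts) = hookProduct t * hookProducts ts

{-# OPTIONS --safe #-}
-- In a game that necessarily follows s Bob plays a_{i+1} in round i, so an initial state is a
-- labelling of the win-loss binary tree of s by Bob's cards, read in level order.  Alice's hand is a
-- queue holding one card per pending subtree; after a won round the two cards that come back, in
-- either order, face the roots of the two children.  So the game follows s under every putback
-- exactly when Bob's W-round cards decrease along the bottom tree from a₁ downwards and all his
-- L-round cards exceed a₁.  With k − 1 W-rounds this forces a₁ = k, the W-cards {1, …, k − 1} and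
-- the L-cards {k + 1, …, 2k}.  Such labellings are enumerated recursively, each node splitting its
-- remaining cards between its two subtrees; the binomial number of splits makes the count satisfy
-- the hook length recursion, which yields (k − 1)! k! / ∏_{v ≠ a₁} h(v) = (k!)² / ∏_v h(v)
-- since h(a₁) = k.
module Submission where

open import Defs
open import Data.Nat using (ℕ; zero; suc; _+_; _*_; _∸_; _^_; _!; _≤_; _<_; _>_; _<ᵇ_; _≤?_; _<?_; s≤s)
open import Data.Nat.Properties
open import Data.Bool using (Bool; true; false; if_then_else_)
open import Data.Unit using (⊤; tt)
open import Data.Empty using (⊥; ⊥-elim)
open import Data.Product using (_×_; _,_; proj₁; proj₂; uncurry; ∃; ∃₂)
open import Data.Sum using (_⊎_; inj₁; inj₂)
open import Data.Vec using (Vec; []; _∷_; replicate)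
open import Data.List
  using (List; []; _∷_; _++_; length; concat; map; concatMap; filter; applyUpTo; applyDownFrom;
         cartesianProduct; cartesianProductWith)
open import Data.List.Properties
  using (++-assoc; ++-identityʳ; ++-conicalˡ; ++-conicalʳ; ∷-injective; ∷-injectiveˡ; ∷-injectiveʳ; map-++; concat-map;
         length-++; length-map; length-applyUpTo; length-applyDownFrom; reverse-applyUpTo;
         filter-accept; filter-reject; filter-all; filter-none; filter-++)
open import Data.List.Relation.Unary.All as All using (All; []; _∷_)
import Data.List.Relation.Unary.All.Properties as All
open import Data.List.Relation.Unary.AllPairs as AllPairs using (AllPairs; []; _∷_)
import Data.List.Relation.Unary.AllPairs.Properties as AllPairs
open import Data.List.Relation.Unary.Any using (Any; here; there)
open import Data.List.Relation.Unary.Unique.Propositional using (Unique)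
import Data.List.Relation.Unary.Unique.Propositional.Properties as Unique
open import Data.List.Relation.Binary.Pointwise as Pointwise using (Pointwise; []; _∷_)
open import Data.List.Membership.Propositional using (_∈_; lose; find)
open import Data.List.Membership.Propositional.Properties
  using (∈-++⁺ˡ; ∈-++⁺ʳ; ∈-++⁻; ∈-map⁺; ∈-map⁻; ∈-concatMap⁺; ∈-concatMap⁻; ∈-∃++; ∈-applyDownFrom⁻;
         ∈-cartesianProductWith⁺; ∈-cartesianProductWith⁻; ∈-cartesianProduct⁺; ∈-cartesianProduct⁻)
open import Data.List.Membership.Propositional.Properties.WithK using (unique∧set⇒bag)
open import Data.List.Relation.Binary.BagAndSetEquality using (∼bag⇒↭)
open import Data.List.Relation.Binary.Permutation.Propositional
  using (_↭_; ↭-refl; ↭-sym; ↭-trans; ↭-reflexive; prep; module PermutationReasoning)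
open import Data.List.Relation.Binary.Permutation.Propositional.Properties
  using (++⁺; ++⁺ˡ; ++⁺ʳ; ++-comm; shift; shifts; drop-∷; ↭-length; ↭-reverse; ↭-empty-inv; ↭-singleton-inv;
         ∈-resp-↭; All-resp-↭; filter-↭)
open import Algebra.Properties.CommutativeSemigroup +-commutativeSemigroup using (interchange)
open import Algebra.Properties.CommutativeSemigroup *-commutativeSemigroup using (x∙yz≈y∙xz)
open import Data.Nat.Tactic.RingSolver using (solve-∀)
open import Function.Base using (_∘_; case_of_)
open import Function.Bundles using (_⇔_; mk⇔; Equivalence)
open import Function.Properties.Equivalence using () renaming (trans to ⇔-trans; sym to ⇔-sym)
open import Level using (0ℓ)
open import Relation.Nullary using (¬?; yes; no)
open import Relation.Nullary.Reflects using (ofʸ; ofⁿ)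
open import Relation.Unary using (Pred; Decidable; ∁)
open import Relation.Binary.PropositionalEquality

private variable
  A B C : Set

Pointwise-++⁻ : ∀ {R : A → B → Set} ws {xs ys zs} → length ws ≡ length xs →
                Pointwise R (ws ++ ys) (xs ++ zs) → Pointwise R ws xs × Pointwise R ys zs
Pointwise-++⁻ []       {[]}    _   rs       = [] , rs
Pointwise-++⁻ (w ∷ ws) {x ∷ xs} len (r ∷ rs) with Pointwise-++⁻ ws (suc-injective len) rs
... | rs₁ , rs₂ = r ∷ rs₁ , rs₂

split-length : ∀ m {n} (zs : List A) → length zs ≡ m + n →
               ∃₂ λ xs ys → length xs ≡ m × length ys ≡ n × xs ++ ys ≡ zs
split-length zero    zs       e = [] , zs , refl , e , refl
split-length (suc m) (z ∷ zs) e with split-length m zs (suc-injective e)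
... | xs , ys , ex , ey , eq = z ∷ xs , ys , cong suc ex , ey , cong (z ∷_) eq

concat-split : (yss : List (List B)) (zs : List A) → length zs ≡ length (concat yss) →
               ∃ λ xss → map length xss ≡ map length yss × concat xss ≡ zs
concat-split []         []  e = [] , refl , refl
concat-split (ys ∷ yss) zs  e with split-length (length ys) zs (trans e (length-++ ys))
... | xs , zs′ , ex , ey , refl with concat-split yss zs′ ey
... | xss , es , refl = xs ∷ xss , cong₂ _∷_ ex es , refl

++-injective : (xs ys : List A) {xs′ ys′ : List A} → length xs ≡ length ys →
               xs ++ xs′ ≡ ys ++ ys′ → xs ≡ ys × xs′ ≡ ys′
++-injective []       []       _ eq = refl , eq
++-injective (x ∷ xs) (y ∷ ys) e eq with ∷-injective eq
... | refl , eq′ with ++-injective xs ys (suc-injective e) eq′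
... | refl , eq″ = refl , eq″

concat-injective : (xss yss : List (List A)) → map length xss ≡ map length yss → concat xss ≡ concat yss → xss ≡ yss
concat-injective []         []         _ _  = refl
concat-injective (xs ∷ xss) (ys ∷ yss) e eq with ∷-injective e
... | e₁ , e₂ with ++-injective xs ys e₁ eq
... | refl , eq′ = cong (xs ∷_) (concat-injective xss yss e₂ eq′)

merge : List (List A) → List (List A) → List (List A)
merge []       ys       = ys
merge (x ∷ xs) []       = x ∷ xs
merge (x ∷ xs) (y ∷ ys) = (x ++ y) ∷ merge xs ys

merge-identityʳ : (xs : List (List A)) → merge xs [] ≡ xs
merge-identityʳ []       = refl
merge-identityʳ (x ∷ xs) = refl

merge-assoc : (xs ys zs : List (List A)) → merge (merge xs ys) zs ≡ merge xs (merge ys zs)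
merge-assoc []       ys       zs       = refl
merge-assoc (x ∷ xs) []       zs       = refl
merge-assoc (x ∷ xs) (y ∷ ys) []       = refl
merge-assoc (x ∷ xs) (y ∷ ys) (z ∷ zs) = cong₂ _∷_ (++-assoc x y z) (merge-assoc xs ys zs)

map-merge : (f : A → B) (xs ys : List (List A)) →
            map (map f) (merge xs ys) ≡ merge (map (map f) xs) (map (map f) ys)
map-merge f []       ys       = refl
map-merge f (x ∷ xs) []       = refl
map-merge f (x ∷ xs) (y ∷ ys) = cong₂ _∷_ (map-++ f x y) (map-merge f xs ys)

mergeLevels≡merge : ∀ xs ys → mergeLevels xs ys ≡ merge xs ys
mergeLevels≡merge []       ys       = refl
mergeLevels≡merge (x ∷ xs) []       = refl
mergeLevels≡merge (x ∷ xs) (y ∷ ys) = cong ((x ++ y) ∷_) (mergeLevels≡merge xs ys)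

merge-split : (xss yss : List (List A)) (zss : List (List B)) → map length zss ≡ map length (merge xss yss) →
  ∃₂ λ xss′ yss′ → map length xss′ ≡ map length xss × map length yss′ ≡ map length yss ×
                   merge xss′ yss′ ≡ zss
merge-split []         yss        zss        e = [] , zss , refl , e , refl
merge-split (xs ∷ xss) []         zss        e = zss , [] , e , refl , merge-identityʳ zss
merge-split (xs ∷ xss) (ys ∷ yss) (zs ∷ zss) e with ∷-injective e
... | e₁ , e₂ with split-length (length xs) zs (trans e₁ (length-++ xs)) | merge-split xss yss zss e₂
... | xs′ , ys′ , ex , ey , refl | xss′ , yss′ , exs , eys , refl =
  xs′ ∷ xss′ , ys′ ∷ yss′ , cong₂ _∷_ ex exs , cong₂ _∷_ ey eys , refl

merge-injective : (xss xss′ yss yss′ : List (List A)) → map length xss ≡ map length xss′ →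
  map length yss ≡ map length yss′ → merge xss yss ≡ merge xss′ yss′ → xss ≡ xss′ × yss ≡ yss′
merge-injective []         []           yss        yss′         _  _  eq = refl , eq
merge-injective (xs ∷ xss) (xs′ ∷ xss′) []         []           _  _  eq = eq , refl
merge-injective (xs ∷ xss) (xs′ ∷ xss′) (ys ∷ yss) (ys′ ∷ yss′) ex ey eq
  with ∷-injective ex | ∷-injective ey | ∷-injective eq
... | ex₁ , ex₂ | ey₁ , ey₂ | eq₁ , eq₂
  with ++-injective xs xs′ ex₁ eq₁ | merge-injective xss xss′ yss yss′ ex₂ ey₂ eq₂
... | refl , refl | refl , refl = refl , refl

concat-merge-↭ : (xss yss : List (List A)) → concat (merge xss yss) ↭ concat xss ++ concat yss
concat-merge-↭ []         yss        = ↭-refl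
concat-merge-↭ (xs ∷ xss) []         = ↭-sym (↭-reflexive (++-identityʳ (concat (xs ∷ xss))))
concat-merge-↭ (xs ∷ xss) (ys ∷ yss) = begin
  (xs ++ ys) ++ concat (merge xss yss)  ≡⟨ ++-assoc xs ys _ ⟩
  xs ++ ys ++ concat (merge xss yss)    ↭⟨ ++⁺ˡ xs (++⁺ˡ ys (concat-merge-↭ xss yss)) ⟩
  xs ++ ys ++ concat xss ++ concat yss  ↭⟨ ++⁺ˡ xs (shifts ys (concat xss)) ⟩
  xs ++ concat xss ++ ys ++ concat yss  ≡⟨ ++-assoc xs (concat xss) _ ⟨
  (xs ++ concat xss) ++ ys ++ concat yss ∎
  where open PermutationReasoning

length-concat-merge : (xss yss : List (List A)) →
  length (concat (merge xss yss)) ≡ length (concat xss) + length (concat yss)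
length-concat-merge xss yss = trans (↭-length (concat-merge-↭ xss yss)) (length-++ (concat xss))

map-length-map : (f : A → B) (xss : List (List A)) → map length (map (map f) xss) ≡ map length xss
map-length-map f []         = refl
map-length-map f (xs ∷ xss) = cong₂ _∷_ (length-map f xs) (map-length-map f xss)

length-concatMap-const : (f : A → List B) (xs : List A) {c : ℕ} → (∀ {x} → x ∈ xs → length (f x) ≡ c) →
                         length (concatMap f xs) ≡ length xs * c
length-concatMap-const f []       h = refl
length-concatMap-const f (x ∷ xs) h =
  trans (length-++ (f x)) (cong₂ _+_ (h (here refl)) (length-concatMap-const f xs (h ∘ there)))

length-cartesianProductWith : (f : A → B → C) (xs : List A) (ys : List B) →
                              length (cartesianProductWith f xs ys) ≡ length xs * length ys
length-cartesianProductWith f []       ys = refl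
length-cartesianProductWith f (x ∷ xs) ys =
  trans (length-++ (map (f x) ys)) (cong₂ _+_ (length-map (f x) ys) (length-cartesianProductWith f xs ys))

Unique-concatMap⁺ : (f : A → List B) {xs : List A} → Unique xs → (∀ {x} → x ∈ xs → Unique (f x)) →
  (∀ {x y z} → x ∈ xs → y ∈ xs → z ∈ f x → z ∈ f y → x ≡ y) → Unique (concatMap f xs)
Unique-concatMap⁺ f []             _     _      = []
Unique-concatMap⁺ f {x ∷ xs} (x∉ ∷ u) uniq sep =
  Unique.++⁺ (uniq (here refl)) (Unique-concatMap⁺ f u (uniq ∘ there) (λ i j → sep (there i) (there j)))
    (λ (z∈fx , z∈rest) → apart z∈fx (∈-concatMap⁻ f {xs = xs} z∈rest))
  where
  apart : ∀ {z} → z ∈ f x → Any (λ y → z ∈ f y) xs → ⊥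
  apart z∈fx z∈fys with find z∈fys
  ... | y , y∈xs , z∈fy with sep (here refl) (there y∈xs) z∈fx z∈fy
  ... | refl = All.lookup x∉ y∈xs refl

Unique-map⁺-on : (f : A → B) {xs : List A} → (∀ {x y} → x ∈ xs → y ∈ xs → f x ≡ f y → x ≡ y) →
              Unique xs → Unique (map f xs)
Unique-map⁺-on f         inj []         = []
Unique-map⁺-on f {x ∷ _} inj (x∉ ∷ uxs) =
  All.map⁺ (All.tabulate (λ y∈ fx≡fy → All.lookup x∉ y∈ (inj (here refl) (there y∈) fx≡fy)))
  ∷ Unique-map⁺-on f (λ i j → inj (there i) (there j)) uxs

sameMembers⇒length≡ : {xs ys : List A} → Unique xs → Unique ys → (∀ {z} → z ∈ xs ⇔ z ∈ ys) →
                      length xs ≡ length ys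
sameMembers⇒length≡ uxs uys same = ↭-length (∼bag⇒↭ (unique∧set⇒bag uxs uys same))

module _ {A : Set} {P : Pred A 0ℓ} (P? : Decidable P) where

  filter-keepˡ : ∀ {xs ys} → All P xs → All (∁ P) ys → filter P? (xs ++ ys) ≡ xs
  filter-keepˡ {xs} {ys} pxs ¬pys = begin
    filter P? (xs ++ ys)          ≡⟨ filter-++ P? xs ys ⟩
    filter P? xs ++ filter P? ys  ≡⟨ cong₂ _++_ (filter-all P? pxs) (filter-none P? ¬pys) ⟩
    xs ++ []                      ≡⟨ ++-identityʳ xs ⟩
    xs                            ∎
    where open ≡-Reasoning

  filter-keepʳ : ∀ {xs ys} → All (∁ P) xs → All P ys → filter P? (xs ++ ys) ≡ ys
  filter-keepʳ {xs} {ys} ¬pxs pys =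
    trans (filter-++ P? xs ys) (cong₂ _++_ (filter-none P? ¬pxs) (filter-all P? pys))

↭-partition : ∀ {P : Pred A 0ℓ} (P? : Decidable P) {xs ys xs′ ys′} →
              All P xs → All (∁ P) ys → All P xs′ → All (∁ P) ys′ →
              xs ++ ys ↭ xs′ ++ ys′ → xs ↭ xs′ × ys ↭ ys′
↭-partition {P = P} P? pxs ¬pys pxs′ ¬pys′ p =
  ↭-trans (↭-reflexive (sym (filter-keepˡ P? pxs ¬pys)))
    (↭-trans (filter-↭ P? p) (↭-reflexive (filter-keepˡ P? pxs′ ¬pys′))) ,
  ↭-trans (↭-reflexive (sym (filter-keepʳ ∁P? (¬¬ pxs) ¬pys)))
    (↭-trans (filter-↭ ∁P? p) (↭-reflexive (filter-keepʳ ∁P? (¬¬ pxs′) ¬pys′)))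
  where
  ∁P? : Decidable (∁ P)
  ∁P? x = ¬? (P? x)
  ¬¬ : ∀ {zs} → All P zs → All (∁ (∁ P)) zs
  ¬¬ = All.map (λ pz ¬pz → ¬pz pz)

afterRound : Bool → ℕ → List ℕ → ℕ → List ℕ → List ℕ × List ℕ
afterRound c a A b B = if b <ᵇ a then (A ++ putback c a b , B) else (A , B ++ putback c b a)

follows-∷ : ∀ {x s c cs a A b B} → Follows (x ∷ s) (c ∷ cs) (a ∷ A) (b ∷ B) ⇔
            (outcome a b ≡ x × uncurry (Follows s cs) (afterRound c a A b B))
follows-∷ {a = a} {b = b} with b <ᵇ a in eq
... | true  rewrite eq = mk⇔ (λ h → h) (λ h → h)
... | false rewrite eq = mk⇔ (λ h → h) (λ h → h)

AllFollow : List Letter → List ℕ → List ℕ → Set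
AllFollow [] A B = (A ≡ []) ⊎ (B ≡ [])
AllFollow (x ∷ s) [] B = ⊥
AllFollow (x ∷ s) (a ∷ A) [] = ⊥
AllFollow (x ∷ s) (a ∷ A) (b ∷ B) =
  outcome a b ≡ x × ((c : Bool) → uncurry (AllFollow s) (afterRound c a A b B))

everyChoice⇔allFollow : ∀ s A B → ((cs : Vec Bool (length s)) → Follows s cs A B) ⇔ AllFollow s A B
everyChoice⇔allFollow s A B = mk⇔ (to s A B) (from s A B)
  where
  someChoice : ∀ n → Vec Bool n
  someChoice n = replicate n true

  to : ∀ s A B → ((cs : Vec Bool (length s)) → Follows s cs A B) → AllFollow s A B
  to []      A       B       h = h []
  to (x ∷ s) []      B       h = h (someChoice _)
  to (x ∷ s) (a ∷ A) []      h = h (someChoice _)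
  to (x ∷ s) (a ∷ A) (b ∷ B) h =
    proj₁ (afterChoice true (someChoice _)) , λ c → to s _ _ (λ cs → proj₂ (afterChoice c cs))
    where
    afterChoice : ∀ c cs → outcome a b ≡ x × uncurry (Follows s cs) (afterRound c a A b B)
    afterChoice c cs = Equivalence.to follows-∷ (h (c ∷ cs))

  from : ∀ s A B → AllFollow s A B → (cs : Vec Bool (length s)) → Follows s cs A B
  from []      A       B       h       []       = h
  from (x ∷ s) (a ∷ A) (b ∷ B) (o , h) (c ∷ cs) = Equivalence.from follows-∷ (o , from s _ _ (h c) cs)

allFollow-win : ∀ {x s a A b B} → b < a →
  AllFollow (x ∷ s) (a ∷ A) (b ∷ B) ⇔ (x ≡ W × ((c : Bool) → AllFollow s (A ++ putback c a b) B))
allFollow-win {a = a} {b = b} b<a with b <ᵇ a | <ᵇ-reflects-< b a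
... | true  | _        = mk⇔ (λ (o , h) → sym o , h) (λ (o , h) → sym o , h)
... | false | ofⁿ b≮a = ⊥-elim (b≮a b<a)

allFollow-lose : ∀ {x s a A b B} → a ≤ b →
  AllFollow (x ∷ s) (a ∷ A) (b ∷ B) ⇔ (x ≡ L × ((c : Bool) → AllFollow s A (B ++ putback c b a)))
allFollow-lose {a = a} {b = b} a≤b with b <ᵇ a | <ᵇ-reflects-< b a
... | true  | ofʸ b<a = ⊥-elim (<⇒≱ b<a a≤b)
... | false | _       = mk⇔ (λ (o , h) → sym o , h) (λ (o , h) → sym o , h)

length-putback : ∀ c (p q : ℕ) → length (putback c p q) ≡ 2
length-putback true  p q = refl
length-putback false p q = refl

-- Labelled win-loss trees

data LTree : Set where
  tip : ℕ → LTree
  bin : ℕ → LTree → LTree → LTree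

shape : LTree → BTree
shape (tip _)     = leaf
shape (bin _ l r) = node (shape l) (shape r)

Round : Set
Round = Letter × ℕ

letters : List Round → List Letter
letters = map proj₁

cards : List Round → List ℕ
cards = map proj₂

root : LTree → Round
root (tip b)     = L , b
root (bin b _ _) = W , b

children : LTree → List LTree
children (tip _)     = []
children (bin _ l r) = l ∷ r ∷ []

roundLevels : LTree → List (List Round)
roundLevels (tip b)     = ((L , b) ∷ []) ∷ []
roundLevels (bin b l r) = ((W , b) ∷ []) ∷ merge (roundLevels l) (roundLevels r)

forestLevels : List LTree → List (List Round)
forestLevels []       = []
forestLevels (u ∷ us) = merge (roundLevels u) (forestLevels us)

roundLevels-root : ∀ u → roundLevels u ≡ (root u ∷ []) ∷ forestLevels (children u)
roundLevels-root (tip b)     = refl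
roundLevels-root (bin b l r) = cong (λ z → ((W , b) ∷ []) ∷ merge (roundLevels l) z) (sym (merge-identityʳ (roundLevels r)))

forestLevels-++ : ∀ xs ys → forestLevels (xs ++ ys) ≡ merge (forestLevels xs) (forestLevels ys)
forestLevels-++ []       ys = refl
forestLevels-++ (u ∷ xs) ys =
  trans (cong (merge (roundLevels u)) (forestLevels-++ xs ys)) (sym (merge-assoc (roundLevels u) (forestLevels xs) (forestLevels ys)))

-- The rounds still to be played, in order, when the subtrees ts₁ are pending on the current level
-- and ts₂ on the next one.
queueOrder : List LTree → List LTree → List Round
queueOrder ts₁ ts₂ = concat (merge ([] ∷ forestLevels ts₂) (forestLevels ts₁))

queueOrder-∷ : ∀ u ts₁ ts₂ → queueOrder (u ∷ ts₁) ts₂ ≡ root u ∷ queueOrder ts₁ (ts₂ ++ children u)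
queueOrder-∷ u ts₁ ts₂ rewrite roundLevels-root u | forestLevels-++ ts₂ (children u) = step (forestLevels ts₁)
  where
  step : ∀ F → concat (merge ([] ∷ forestLevels ts₂) (merge ((root u ∷ []) ∷ forestLevels (children u)) F))
             ≡ root u ∷ concat (merge ([] ∷ merge (forestLevels ts₂) (forestLevels (children u))) F)
  step []      = refl
  step (f ∷ F) = cong (λ z → root u ∷ f ++ concat z) (sym (merge-assoc (forestLevels ts₂) (forestLevels (children u)) F))

queueOrder-∷-letters : ∀ u ts₁ ts₂ {x s} → letters (queueOrder (u ∷ ts₁) ts₂) ≡ x ∷ s →
                       proj₁ (root u) ≡ x × letters (queueOrder ts₁ (ts₂ ++ children u)) ≡ s
queueOrder-∷-letters u ts₁ ts₂ e = ∷-injective (trans (cong letters (sym (queueOrder-∷ u ts₁ ts₂))) e)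

queueOrder-[] : ∀ ts → queueOrder [] ts ≡ queueOrder ts []
queueOrder-[] ts with forestLevels ts
... | []    = refl
... | _ ∷ _ = refl

queueOrder-single : ∀ u → queueOrder (u ∷ []) [] ≡ concat (roundLevels u)
queueOrder-single u rewrite merge-identityʳ (roundLevels u) | roundLevels-root u = refl

letterLevels-shape : ∀ u → map (map proj₁) (roundLevels u) ≡ levels (shape u)
letterLevels-shape (tip b)     = refl
letterLevels-shape (bin b l r) = cong ((W ∷ []) ∷_) (begin
  map (map proj₁) (merge (roundLevels l) (roundLevels r))    ≡⟨ map-merge proj₁ (roundLevels l) (roundLevels r) ⟩
  merge (map (map proj₁) (roundLevels l)) (map (map proj₁) (roundLevels r))
                                                             ≡⟨ cong₂ merge (letterLevels-shape l) (letterLevels-shape r) ⟩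
  merge (levels (shape l)) (levels (shape r))                ≡⟨ mergeLevels≡merge (levels (shape l)) (levels (shape r)) ⟨
  mergeLevels (levels (shape l)) (levels (shape r))          ∎)
  where open ≡-Reasoning

letters-levelOrder : ∀ u → letters (queueOrder (u ∷ []) []) ≡ levelOrder (shape u)
letters-levelOrder u rewrite queueOrder-single u =
  trans (sym (concat-map (roundLevels u))) (cong concat (letterLevels-shape u))

cardLevels : LTree → List (List ℕ)
cardLevels u = map (map proj₂) (roundLevels u)

bobCards : LTree → List ℕ
bobCards u = cards (queueOrder (u ∷ []) [])

bobCards-cardLevels : ∀ u → bobCards u ≡ concat (cardLevels u)
bobCards-cardLevels u rewrite queueOrder-single u = sym (concat-map (roundLevels u))

profile-cardLevels : ∀ u → map length (cardLevels u) ≡ map length (levels (shape u))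
profile-cardLevels u = begin
  map length (map (map proj₂) (roundLevels u))  ≡⟨ map-length-map proj₂ (roundLevels u) ⟩
  map length (roundLevels u)                    ≡⟨ map-length-map proj₁ (roundLevels u) ⟨
  map length (map (map proj₁) (roundLevels u))  ≡⟨ cong (map length) (letterLevels-shape u) ⟩
  map length (levels (shape u))                 ∎
  where open ≡-Reasoning

cardLevels-surjective : ∀ t (bss : List (List ℕ)) → map length bss ≡ map length (levels t) →
                        ∃ λ u → shape u ≡ t × cardLevels u ≡ bss
cardLevels-surjective leaf ((b ∷ []) ∷ []) e = tip b , refl , refl
cardLevels-surjective (node l r) ((b ∷ []) ∷ bss) e
  with merge-split (levels l) (levels r) bss
         (trans (∷-injectiveʳ e) (cong (map length) (mergeLevels≡merge (levels l) (levels r))))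
... | bssₗ , bssᵣ , eₗ , eᵣ , refl with cardLevels-surjective l bssₗ eₗ | cardLevels-surjective r bssᵣ eᵣ
... | uₗ , refl , refl | uᵣ , refl , refl =
  bin b uₗ uᵣ , refl , cong ((b ∷ []) ∷_) (map-merge proj₂ (roundLevels uₗ) (roundLevels uᵣ))

bobCards-surjective : ∀ t (bs : List ℕ) → length bs ≡ length (levelOrder t) → ∃ λ u → shape u ≡ t × bobCards u ≡ bs
bobCards-surjective t bs e with concat-split (levels t) bs e
... | bss , eₚ , refl with cardLevels-surjective t bss eₚ
... | u , su , refl = u , su , bobCards-cardLevels u

sameShape⇒sameProfile : ∀ u v → shape u ≡ shape v → map length (cardLevels u) ≡ map length (cardLevels v)
sameShape⇒sameProfile u v s =
  trans (profile-cardLevels u) (trans (cong (λ t → map length (levels t)) s) (sym (profile-cardLevels v)))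

node-injective : ∀ {l r l′ r′} → node l r ≡ node l′ r′ → l ≡ l′ × r ≡ r′
node-injective refl = refl , refl

cardLevels-injective : ∀ u v → shape u ≡ shape v → cardLevels u ≡ cardLevels v → u ≡ v
cardLevels-injective (tip b)     (tip .b)       _  refl = refl
cardLevels-injective (bin b l r) (bin b′ l′ r′) su eq with ∷-injective eq | node-injective su
... | refl , eq′ | sₗ , sᵣ
  with merge-injective (cardLevels l) (cardLevels l′) (cardLevels r) (cardLevels r′)
         (sameShape⇒sameProfile l l′ sₗ) (sameShape⇒sameProfile r r′ sᵣ)
         (trans (sym (map-merge proj₂ (roundLevels l) (roundLevels r)))
                (trans eq′ (map-merge proj₂ (roundLevels l′) (roundLevels r′))))
... | eₗ , eᵣ = cong₂ (bin b) (cardLevels-injective l l′ sₗ eₗ) (cardLevels-injective r r′ sᵣ eᵣ)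

bobCards-injective : ∀ u v → shape u ≡ shape v → bobCards u ≡ bobCards v → u ≡ v
bobCards-injective u v s eq = cardLevels-injective u v s
  (concat-injective (cardLevels u) (cardLevels v) (sameShape⇒sameProfile u v s)
    (trans (sym (bobCards-cardLevels u)) (trans eq (bobCards-cardLevels v))))

wCards : LTree → List ℕ
wCards (tip _)     = []
wCards (bin b l r) = b ∷ wCards l ++ wCards r

lCards : LTree → List ℕ
lCards (tip b)     = b ∷ []
lCards (bin b l r) = lCards l ++ lCards r

cardLevels↭ : ∀ u → concat (cardLevels u) ↭ wCards u ++ lCards u
cardLevels↭ (tip b)     = ↭-refl
cardLevels↭ (bin b l r) = prep b (begin
  concat (map (map proj₂) (merge (roundLevels l) (roundLevels r)))
    ≡⟨ cong concat (map-merge proj₂ (roundLevels l) (roundLevels r)) ⟩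
  concat (merge (cardLevels l) (cardLevels r))          ↭⟨ concat-merge-↭ (cardLevels l) (cardLevels r) ⟩
  concat (cardLevels l) ++ concat (cardLevels r)        ↭⟨ ++⁺ʳ _ (cardLevels↭ l) ⟩
  (wCards l ++ lCards l) ++ concat (cardLevels r)       ↭⟨ ++⁺ˡ (wCards l ++ lCards l) (cardLevels↭ r) ⟩
  (wCards l ++ lCards l) ++ (wCards r ++ lCards r)      ≡⟨ ++-assoc (wCards l) (lCards l) _ ⟩
  wCards l ++ lCards l ++ wCards r ++ lCards r          ↭⟨ ++⁺ˡ (wCards l) (shifts (lCards l) (wCards r)) ⟩
  wCards l ++ wCards r ++ lCards l ++ lCards r          ≡⟨ ++-assoc (wCards l) (wCards r) _ ⟨
  (wCards l ++ wCards r) ++ lCards l ++ lCards r        ∎)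
  where open PermutationReasoning

bobCards↭ : ∀ u → bobCards u ↭ wCards u ++ lCards u
bobCards↭ u = ↭-trans (↭-reflexive (bobCards-cardLevels u)) (cardLevels↭ u)

internals : BTree → ℕ
internals leaf       = 0
internals (node l r) = suc (internals l + internals r)

leaves : BTree → ℕ
leaves leaf       = 1
leaves (node l r) = leaves l + leaves r

leaves≡suc-internals : ∀ t → leaves t ≡ suc (internals t)
leaves≡suc-internals leaf       = refl
leaves≡suc-internals (node l r) rewrite leaves≡suc-internals l | leaves≡suc-internals r =
  cong suc (+-suc (internals l) (internals r))

length-wCards : ∀ u → length (wCards u) ≡ internals (shape u)
length-wCards (tip _)     = refl
length-wCards (bin b l r) = cong suc (trans (length-++ (wCards l)) (cong₂ _+_ (length-wCards l) (length-wCards r)))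

length-lCards : ∀ u → length (lCards u) ≡ leaves (shape u)
length-lCards (tip _)     = refl
length-lCards (bin b l r) = trans (length-++ (lCards l)) (cong₂ _+_ (length-lCards l) (length-lCards r))

length-levelOrder : ∀ t → length (levelOrder t) ≡ internals t + leaves t
length-levelOrder leaf       = refl
length-levelOrder (node l r) = cong suc (begin
  length (concat (mergeLevels (levels l) (levels r)))  ≡⟨ cong (length ∘ concat) (mergeLevels≡merge (levels l) (levels r)) ⟩
  length (concat (merge (levels l) (levels r)))        ≡⟨ length-concat-merge (levels l) (levels r) ⟩
  length (levelOrder l) + length (levelOrder r)        ≡⟨ cong₂ _+_ (length-levelOrder l) (length-levelOrder r) ⟩
  (internals l + leaves l) + (internals r + leaves r)  ≡⟨ interchange (internals l) (leaves l) (internals r) (leaves r) ⟩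
  (internals l + internals r) + (leaves l + leaves r)  ∎)
  where open ≡-Reasoning

-- Following s under every putback

-- Alice plays c against the root of u; her winning card and Bob's card come back, in either order,
-- as her cards against the roots of the two subtrees.
Consistent : LTree → ℕ → Set
Consistent (tip b)     c = c ≤ b
Consistent (bin b l r) c = b < c × (Consistent l c × Consistent r b) × (Consistent l b × Consistent r c)

-- Alice holds A against the pending subtrees ts₁ ++ ts₂; Bob holds the cards of their rounds in
-- order, followed by the cards J he has won, which he does not get to play before the game ends.
mutual
  allFollow⇒consistent : ∀ s ts₁ ts₂ {A J} → letters (queueOrder ts₁ ts₂) ≡ s →
    length A ≡ length (ts₁ ++ ts₂) →
    AllFollow s A (cards (queueOrder ts₁ ts₂) ++ J) → Pointwise Consistent (ts₁ ++ ts₂) A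
  allFollow⇒consistent s [] [] {[]} _ _ _ = []
  allFollow⇒consistent s [] (u ∷ ts) {A} {J} e len h =
    subst (λ q → Pointwise Consistent q A) (++-identityʳ (u ∷ ts))
      (allFollow⇒consistent-pop s u ts []
        (trans (cong letters (sym (queueOrder-[] (u ∷ ts)))) e)
        (trans len (cong length (sym (++-identityʳ (u ∷ ts)))))
        (subst (λ q → AllFollow s A (cards q ++ J)) (queueOrder-[] (u ∷ ts)) h))
  allFollow⇒consistent s (u ∷ ts₁) ts₂ e len h = allFollow⇒consistent-pop s u ts₁ ts₂ e len h

  allFollow⇒consistent-pop : ∀ s u ts₁ ts₂ {A J} → letters (queueOrder (u ∷ ts₁) ts₂) ≡ s →
    length A ≡ length (u ∷ ts₁ ++ ts₂) →
    AllFollow s A (cards (queueOrder (u ∷ ts₁) ts₂) ++ J) → Pointwise Consistent (u ∷ ts₁ ++ ts₂) A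
  allFollow⇒consistent-pop []      u ts₁ ts₂ e = case trans (cong letters (sym (queueOrder-∷ u ts₁ ts₂))) e of λ ()
  allFollow⇒consistent-pop (x ∷ s) u ts₁ ts₂ {[]}    e ()
  allFollow⇒consistent-pop (x ∷ s) u ts₁ ts₂ {a ∷ A} {J} e len h with queueOrder-∷-letters u ts₁ ts₂ e
  ... | x≡ , s≡ = allFollow⇒consistent-round s u ts₁ ts₂ x≡ s≡ (suc-injective len)
      (subst (λ q → AllFollow (x ∷ s) (a ∷ A) (cards q ++ J)) (queueOrder-∷ u ts₁ ts₂) h)

  allFollow⇒consistent-round : ∀ {x} s u ts₁ ts₂ {a A J} → proj₁ (root u) ≡ x →
    letters (queueOrder ts₁ (ts₂ ++ children u)) ≡ s → length A ≡ length (ts₁ ++ ts₂) →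
    AllFollow (x ∷ s) (a ∷ A) (proj₂ (root u) ∷ cards (queueOrder ts₁ (ts₂ ++ children u)) ++ J) →
    Pointwise Consistent (u ∷ ts₁ ++ ts₂) (a ∷ A)
  allFollow⇒consistent-round s (tip b) ts₁ ts₂ {a} {A} {J} refl e len h with a ≤? b
  ... | no a≰b  = case proj₁ (Equivalence.to (allFollow-win (≰⇒> a≰b)) h) of λ ()
  ... | yes a≤b = a≤b ∷ subst (λ q → Pointwise Consistent (ts₁ ++ q) A) (++-identityʳ ts₂)
                          (allFollow⇒consistent s ts₁ (ts₂ ++ []) e len′ afterLoss)
    where
    len′ : length A ≡ length (ts₁ ++ ts₂ ++ [])
    len′ = trans len (cong (λ q → length (ts₁ ++ q)) (sym (++-identityʳ ts₂)))
    afterLoss : AllFollow s A (cards (queueOrder ts₁ (ts₂ ++ [])) ++ J ++ b ∷ a ∷ [])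
    afterLoss = subst (AllFollow s A) (++-assoc (cards (queueOrder ts₁ (ts₂ ++ []))) J _)
                  (proj₂ (Equivalence.to (allFollow-lose a≤b) h) true)
  allFollow⇒consistent-round s (bin b l r) ts₁ ts₂ {a} {A} {J} refl e len h with b <? a
  ... | no b≮a = case proj₁ (Equivalence.to (allFollow-lose (≮⇒≥ b≮a)) h) of λ ()
  ... | yes b<a with Pointwise-++⁻ (ts₁ ++ ts₂) {zs = a ∷ b ∷ []} (sym len) (afterWin true)
                   | Pointwise-++⁻ (ts₁ ++ ts₂) {zs = b ∷ a ∷ []} (sym len) (afterWin false)
    where
    afterWin : ∀ c → Pointwise Consistent ((ts₁ ++ ts₂) ++ l ∷ r ∷ []) (A ++ putback c a b)
    afterWin c = subst (λ q → Pointwise Consistent q (A ++ putback c a b)) (sym (++-assoc ts₁ ts₂ _))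
      (allFollow⇒consistent s ts₁ (ts₂ ++ l ∷ r ∷ []) e
        (begin
          length (A ++ putback c a b)          ≡⟨ length-++ A ⟩
          length A + length (putback c a b)    ≡⟨ cong₂ _+_ len (length-putback c a b) ⟩
          length (ts₁ ++ ts₂) + 2              ≡⟨ length-++ (ts₁ ++ ts₂) ⟨
          length ((ts₁ ++ ts₂) ++ l ∷ r ∷ [])  ≡⟨ cong length (++-assoc ts₁ ts₂ _) ⟩
          length (ts₁ ++ ts₂ ++ l ∷ r ∷ [])    ∎)
        (proj₂ (Equivalence.to (allFollow-win b<a) h) c))
      where open ≡-Reasoning
  ... | pw , cla ∷ crb ∷ [] | _ , clb ∷ cra ∷ [] = (b<a , (cla , crb) , (clb , cra)) ∷ pw

mutual
  consistent⇒allFollow : ∀ s ts₁ ts₂ {A J} → letters (queueOrder ts₁ ts₂) ≡ s →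
    Pointwise Consistent (ts₁ ++ ts₂) A → AllFollow s A (cards (queueOrder ts₁ ts₂) ++ J)
  consistent⇒allFollow .[] [] [] refl [] = inj₁ refl
  consistent⇒allFollow s [] (u ∷ ts) {A} {J} e cs =
    subst (λ q → AllFollow s A (cards q ++ J)) (sym (queueOrder-[] (u ∷ ts)))
      (consistent⇒allFollow-pop s u ts []
        (trans (cong letters (sym (queueOrder-[] (u ∷ ts)))) e)
        (subst (λ q → Pointwise Consistent q A) (sym (++-identityʳ (u ∷ ts))) cs))
  consistent⇒allFollow s (u ∷ ts₁) ts₂ e cs = consistent⇒allFollow-pop s u ts₁ ts₂ e cs

  consistent⇒allFollow-pop : ∀ s u ts₁ ts₂ {A J} → letters (queueOrder (u ∷ ts₁) ts₂) ≡ s →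
    Pointwise Consistent (u ∷ ts₁ ++ ts₂) A → AllFollow s A (cards (queueOrder (u ∷ ts₁) ts₂) ++ J)
  consistent⇒allFollow-pop []      u ts₁ ts₂ e = case trans (cong letters (sym (queueOrder-∷ u ts₁ ts₂))) e of λ ()
  consistent⇒allFollow-pop (x ∷ s) u ts₁ ts₂ {a ∷ A} {J} e (c ∷ cs) with queueOrder-∷-letters u ts₁ ts₂ e
  ... | x≡ , s≡ = subst (λ q → AllFollow (x ∷ s) (a ∷ A) (cards q ++ J)) (sym (queueOrder-∷ u ts₁ ts₂))
                    (consistent⇒allFollow-round s u ts₁ ts₂ x≡ s≡ c cs)

  consistent⇒allFollow-round : ∀ {x} s u ts₁ ts₂ {a A J} → proj₁ (root u) ≡ x →
    letters (queueOrder ts₁ (ts₂ ++ children u)) ≡ s → Consistent u a → Pointwise Consistent (ts₁ ++ ts₂) A →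
    AllFollow (x ∷ s) (a ∷ A) (proj₂ (root u) ∷ cards (queueOrder ts₁ (ts₂ ++ children u)) ++ J)
  consistent⇒allFollow-round s (tip b) ts₁ ts₂ {a} {A} {J} refl e a≤b cs =
    Equivalence.from (allFollow-lose a≤b) (refl , λ c →
      subst (AllFollow s A) (sym (++-assoc (cards (queueOrder ts₁ (ts₂ ++ []))) J (putback c b a)))
        (consistent⇒allFollow s ts₁ (ts₂ ++ []) e
          (subst (λ q → Pointwise Consistent (ts₁ ++ q) A) (sym (++-identityʳ ts₂)) cs)))
  consistent⇒allFollow-round s (bin b l r) ts₁ ts₂ {a} {A} {J} refl e (b<a , (cla , crb) , (clb , cra)) cs =
    Equivalence.from (allFollow-win b<a) (refl , λ c → consistent⇒allFollow s ts₁ (ts₂ ++ l ∷ r ∷ []) e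
      (subst (λ q → Pointwise Consistent q (A ++ putback c a b)) (++-assoc ts₁ ts₂ _)
        (Pointwise.++⁺ cs (returned c))))
    where
    returned : ∀ c → Pointwise Consistent (l ∷ r ∷ []) (putback c a b)
    returned true  = cla ∷ crb ∷ []
    returned false = clb ∷ cra ∷ []

necessarilyFollows⇔consistent : ∀ u a → NecessarilyFollows (levelOrder (shape u)) (a ∷ bobCards u) ⇔ Consistent u a
necessarilyFollows⇔consistent u a = ⇔-trans (everyChoice⇔allFollow _ (a ∷ []) (bobCards u)) (mk⇔
  (λ h → singleton⁻ (allFollow⇒consistent _ (u ∷ []) [] (letters-levelOrder u) refl
                       (subst (AllFollow _ (a ∷ [])) (sym (++-identityʳ _)) h)))
  (λ c → subst (AllFollow _ (a ∷ [])) (++-identityʳ _)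
           (consistent⇒allFollow _ (u ∷ []) [] (letters-levelOrder u) (c ∷ []))))
  where
  singleton⁻ : ∀ {x} → Pointwise Consistent (u ∷ []) (x ∷ []) → Consistent u x
  singleton⁻ (c ∷ []) = c

DecreasingBelow : LTree → ℕ → Set
DecreasingBelow (tip _)     c = ⊤
DecreasingBelow (bin b l r) c = b < c × DecreasingBelow l b × DecreasingBelow r b

decreasingBelow-weaken : ∀ u {c c′} → c ≤ c′ → DecreasingBelow u c → DecreasingBelow u c′
decreasingBelow-weaken (tip _)     _    _              = tt
decreasingBelow-weaken (bin b l r) c≤c′ (b<c , dₗ , dᵣ) = <-≤-trans b<c c≤c′ , dₗ , dᵣ

decreasingBelow⇒wCards< : ∀ u {c} → DecreasingBelow u c → All (_< c) (wCards u)
decreasingBelow⇒wCards< (tip _)     _               = []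
decreasingBelow⇒wCards< (bin b l r) (b<c , dₗ , dᵣ) =
  b<c ∷ All.map (λ x<b → <-trans x<b b<c) (All.++⁺ (decreasingBelow⇒wCards< l dₗ) (decreasingBelow⇒wCards< r dᵣ))

consistent⇔decreasing : ∀ u c → Consistent u c ⇔ (DecreasingBelow u c × All (c ≤_) (lCards u))
consistent⇔decreasing u c = mk⇔ (λ h → to u h , lCards≥ u h) (λ (d , a) → from u d a)
  where
  to : ∀ u {c} → Consistent u c → DecreasingBelow u c
  to (tip _)     _                             = tt
  to (bin b l r) (b<c , (_ , crb) , (clb , _)) = b<c , to l clb , to r crb
  lCards≥ : ∀ u {c} → Consistent u c → All (c ≤_) (lCards u)
  lCards≥ (tip _)     c≤b                           = c≤b ∷ []
  lCards≥ (bin b l r) (_ , (clc , _) , (_ , crc)) = All.++⁺ (lCards≥ l clc) (lCards≥ r crc)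
  from : ∀ u {c} → DecreasingBelow u c → All (c ≤_) (lCards u) → Consistent u c
  from (tip _)     _               (c≤b ∷ []) = c≤b
  from (bin b l r) {c} (b<c , dₗ , dᵣ) a with All.++⁻ (lCards l) a
  ... | aₗ , aᵣ = b<c , (from l (decreasingBelow-weaken l (<⇒≤ b<c) dₗ) aₗ , from r dᵣ (weaken aᵣ))
                      , (from l dₗ (weaken aₗ) , from r (decreasingBelow-weaken r (<⇒≤ b<c) dᵣ) aᵣ)
    where
    weaken : ∀ {xs} → All (c ≤_) xs → All (b ≤_) xs
    weaken = All.map (λ c≤x → ≤-trans (<⇒≤ b<c) c≤x)

select : List Bool → List A → List A
select []           xs       = []
select (_ ∷ _)      []       = []
select (true  ∷ m) (x ∷ xs) = x ∷ select m xs
select (false ∷ m) (x ∷ xs) = select m xs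

reject : List Bool → List A → List A
reject []           xs       = xs
reject (_ ∷ _)      []       = []
reject (true  ∷ m) (x ∷ xs) = reject m xs
reject (false ∷ m) (x ∷ xs) = x ∷ reject m xs

trues : List Bool → ℕ
trues []          = 0
trues (true  ∷ m) = suc (trues m)
trues (false ∷ m) = trues m

falses : List Bool → ℕ
falses []          = 0
falses (true  ∷ m) = falses m
falses (false ∷ m) = suc (falses m)

length≡trues+falses : ∀ m → length m ≡ trues m + falses m
length≡trues+falses []          = refl
length≡trues+falses (true  ∷ m) = cong suc (length≡trues+falses m)
length≡trues+falses (false ∷ m) = trans (cong suc (length≡trues+falses m)) (sym (+-suc (trues m) (falses m)))

select++reject↭ : ∀ m (xs : List A) → select m xs ++ reject m xs ↭ xs
select++reject↭ []          xs       = ↭-refl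
select++reject↭ (_ ∷ _)     []       = ↭-refl
select++reject↭ (true  ∷ m) (x ∷ xs) = prep x (select++reject↭ m xs)
select++reject↭ (false ∷ m) (x ∷ xs) = ↭-trans (shift x (select m xs) (reject m xs)) (prep x (select++reject↭ m xs))

∈-select⁻ : ∀ m (xs : List A) {z} → z ∈ select m xs → z ∈ xs
∈-select⁻ (true  ∷ m) (x ∷ xs) (here e)  = here e
∈-select⁻ (true  ∷ m) (x ∷ xs) (there i) = there (∈-select⁻ m xs i)
∈-select⁻ (false ∷ m) (x ∷ xs) i         = there (∈-select⁻ m xs i)

All-select : ∀ {P : A → Set} m {xs} → All P xs → All P (select m xs)
All-select []          _        = []
All-select (_ ∷ _)     []       = []
All-select (true  ∷ m) (p ∷ ps) = p ∷ All-select m ps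
All-select (false ∷ m) (p ∷ ps) = All-select m ps

All-reject : ∀ {P : A → Set} m {xs} → All P xs → All P (reject m xs)
All-reject []          ps       = ps
All-reject (_ ∷ _)     []       = []
All-reject (true  ∷ m) (p ∷ ps) = All-reject m ps
All-reject (false ∷ m) (p ∷ ps) = p ∷ All-reject m ps

AllPairs-select : ∀ {R : A → A → Set} m {xs} → AllPairs R xs → AllPairs R (select m xs)
AllPairs-select []          _        = []
AllPairs-select (_ ∷ _)     []       = []
AllPairs-select (true  ∷ m) (p ∷ ps) = All-select m p ∷ AllPairs-select m ps
AllPairs-select (false ∷ m) (p ∷ ps) = AllPairs-select m ps

AllPairs-reject : ∀ {R : A → A → Set} m {xs} → AllPairs R xs → AllPairs R (reject m xs)
AllPairs-reject []          ps       = ps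
AllPairs-reject (_ ∷ _)     []       = []
AllPairs-reject (true  ∷ m) (p ∷ ps) = AllPairs-reject m ps
AllPairs-reject (false ∷ m) (p ∷ ps) = All-reject m p ∷ AllPairs-reject m ps

length-select : ∀ m (xs : List A) → length m ≡ length xs → length (select m xs) ≡ trues m
length-select []          []       _ = refl
length-select (true  ∷ m) (x ∷ xs) e = cong suc (length-select m xs (suc-injective e))
length-select (false ∷ m) (x ∷ xs) e = length-select m xs (suc-injective e)

length-reject : ∀ m (xs : List A) → length m ≡ length xs → length (reject m xs) ≡ falses m
length-reject []          []       _ = refl
length-reject (true  ∷ m) (x ∷ xs) e = length-reject m xs (suc-injective e)
length-reject (false ∷ m) (x ∷ xs) e = cong suc (length-reject m xs (suc-injective e))

select-injective : ∀ m m′ (xs : List A) → Unique xs → length m ≡ length xs → length m′ ≡ length xs →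
                   select m xs ↭ select m′ xs → m ≡ m′
select-injective []          []           []       _        _ _  _ = refl
select-injective (true  ∷ m) (true  ∷ m′) (x ∷ xs) (_ ∷ u)  e e′ p =
  cong (true ∷_) (select-injective m m′ xs u (suc-injective e) (suc-injective e′) (drop-∷ p))
select-injective (false ∷ m) (false ∷ m′) (x ∷ xs) (_ ∷ u)  e e′ p =
  cong (false ∷_) (select-injective m m′ xs u (suc-injective e) (suc-injective e′) p)
select-injective (true  ∷ m) (false ∷ m′) (x ∷ xs) (x∉ ∷ _) _ _  p =
  ⊥-elim (All.lookup x∉ (∈-select⁻ m′ xs (∈-resp-↭ p (here refl))) refl)
select-injective (false ∷ m) (true  ∷ m′) (x ∷ xs) (x∉ ∷ _) _ _  p =
  ⊥-elim (All.lookup x∉ (∈-select⁻ m xs (∈-resp-↭ (↭-sym p) (here refl))) refl)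

masks : ℕ → ℕ → List (List Bool)
masks zero    zero    = [] ∷ []
masks (suc a) zero    = map (true ∷_) (masks a zero)
masks zero    (suc b) = map (false ∷_) (masks zero b)
masks (suc a) (suc b) = map (true ∷_) (masks a (suc b)) ++ map (false ∷_) (masks (suc a) b)

∈-map-∷⁻ : ∀ {c : Bool} {m ms} → m ∈ map (c ∷_) ms → ∃ λ (m′ : List Bool) → m ≡ c ∷ m′ × m′ ∈ ms
∈-map-∷⁻ {c = c} i with ∈-map⁻ (c ∷_) i
... | m′ , i′ , e = m′ , e , i′

∈-masks⁻ : ∀ a b {m} → m ∈ masks a b → trues m ≡ a × falses m ≡ b
∈-masks⁻ zero    zero    (here refl) = refl , refl
∈-masks⁻ (suc a) zero    i with ∈-map-∷⁻ i
... | m′ , refl , i′ = cong suc (proj₁ (∈-masks⁻ a zero i′)) , proj₂ (∈-masks⁻ a zero i′)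
∈-masks⁻ zero    (suc b) i with ∈-map-∷⁻ i
... | m′ , refl , i′ = proj₁ (∈-masks⁻ zero b i′) , cong suc (proj₂ (∈-masks⁻ zero b i′))
∈-masks⁻ (suc a) (suc b) i with ∈-++⁻ (map (true ∷_) (masks a (suc b))) i
... | inj₁ i₁ with ∈-map-∷⁻ i₁
...   | m′ , refl , i′ = cong suc (proj₁ (∈-masks⁻ a (suc b) i′)) , proj₂ (∈-masks⁻ a (suc b) i′)
∈-masks⁻ (suc a) (suc b) i | inj₂ i₂ with ∈-map-∷⁻ i₂
...   | m′ , refl , i′ = proj₁ (∈-masks⁻ (suc a) b i′) , cong suc (proj₂ (∈-masks⁻ (suc a) b i′))

∈-masks⁺ : ∀ m → m ∈ masks (trues m) (falses m)
∈-masks⁺ []          = here refl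
∈-masks⁺ (true  ∷ m) with falses m | ∈-masks⁺ m
... | zero  | i = ∈-map⁺ (true ∷_) i
... | suc b | i = ∈-++⁺ˡ (∈-map⁺ (true ∷_) i)
∈-masks⁺ (false ∷ m) with trues m | ∈-masks⁺ m
... | zero  | i = ∈-map⁺ (false ∷_) i
... | suc a | i = ∈-++⁺ʳ (map (true ∷_) (masks a (suc (falses m)))) (∈-map⁺ (false ∷_) i)

masks-unique : ∀ a b → Unique (masks a b)
masks-unique zero    zero    = [] ∷ []
masks-unique (suc a) zero    = Unique.map⁺ ∷-injectiveʳ (masks-unique a zero)
masks-unique zero    (suc b) = Unique.map⁺ ∷-injectiveʳ (masks-unique zero b)
masks-unique (suc a) (suc b) =
  Unique.++⁺ (Unique.map⁺ ∷-injectiveʳ (masks-unique a (suc b))) (Unique.map⁺ ∷-injectiveʳ (masks-unique (suc a) b))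
    (λ (i₁ , i₂) → disjoint i₁ i₂)
  where
  disjoint : ∀ {m} → m ∈ map (true ∷_) (masks a (suc b)) → m ∈ map (false ∷_) (masks (suc a) b) → ⊥
  disjoint i₁ i₂ with ∈-map-∷⁻ i₁ | ∈-map-∷⁻ i₂
  ... | _ , refl , _ | _ , () , _

length-masks-zeroʳ : ∀ a → length (masks a zero) ≡ 1
length-masks-zeroʳ zero    = refl
length-masks-zeroʳ (suc a) = trans (length-map (true ∷_) (masks a zero)) (length-masks-zeroʳ a)

length-masks-zeroˡ : ∀ b → length (masks zero b) ≡ 1
length-masks-zeroˡ zero    = refl
length-masks-zeroˡ (suc b) = trans (length-map (false ∷_) (masks zero b)) (length-masks-zeroˡ b)

-- Pascal's rule, multiplied out by a! b!.
length-masks : ∀ a b → length (masks a b) * (a ! * b !) ≡ (a + b) !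
length-masks zero    zero    = refl
length-masks (suc a) zero    rewrite length-masks-zeroʳ (suc a) | +-identityʳ a =
  trans (*-identityˡ _) (*-identityʳ _)
length-masks zero    (suc b) rewrite length-masks-zeroˡ (suc b) = trans (*-identityˡ _) (*-identityˡ _)
length-masks (suc a) (suc b) = begin
  length (masks (suc a) (suc b)) * (suc a ! * suc b !)
    ≡⟨ cong (_* (suc a ! * suc b !)) (trans (length-++ (map (true ∷_) (masks a (suc b))))
         (cong₂ _+_ (length-map (true ∷_) (masks a (suc b))) (length-map (false ∷_) (masks (suc a) b)))) ⟩
  (x + y) * ((suc a * a !) * (suc b * b !))
    ≡⟨ expand x y (a !) (b !) a b ⟩
  suc a * (x * (a ! * suc b !)) + suc b * (y * (suc a ! * b !))
    ≡⟨ cong₂ (λ p q → suc a * p + suc b * q) (length-masks a (suc b)) (length-masks (suc a) b) ⟩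
  suc a * (a + suc b) ! + suc b * (suc a + b) !
    ≡⟨ cong (λ n → suc a * n ! + suc b * (suc a + b) !) (+-suc a b) ⟩
  suc a * (suc a + b) ! + suc b * (suc a + b) !
    ≡⟨ *-distribʳ-+ ((suc a + b) !) (suc a) (suc b) ⟨
  (suc a + suc b) * (suc a + b) !
    ≡⟨ cong (λ n → (suc a + suc b) * n !) (+-suc a b) ⟨
  (suc a + suc b) !  ∎
  where
  open ≡-Reasoning
  x y : ℕ
  x = length (masks a (suc b))
  y = length (masks (suc a) b)
  expand : ∀ x y p q a b →
    (x + y) * ((suc a * p) * (suc b * q)) ≡ suc a * (x * (p * (suc b * q))) + suc b * (y * ((suc a * p) * q))
  expand = solve-∀

mask-lengths : ∀ {a b m} (V : List A) → m ∈ masks a b → length V ≡ a + b →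
               length m ≡ length V × length (select m V) ≡ a × length (reject m V) ≡ b
mask-lengths {a = a} {b} {m} V m∈ e with ∈-masks⁻ a b m∈
... | refl , refl = len , length-select m V len , length-reject m V len
  where
  len : length m ≡ length V
  len = trans (length≡trues+falses m) (sym e)

private
  splitting-mask : ∀ (V P Q : List A) → P ++ Q ↭ V →
                   ∃ λ m → length m ≡ length V × select m V ↭ P × reject m V ↭ Q
  splitting-mask [] P Q p with ++-conicalˡ P Q (↭-empty-inv p) | ++-conicalʳ P Q (↭-empty-inv p)
  ... | refl | refl = [] , refl , ↭-refl , ↭-refl
  splitting-mask (v ∷ V) P Q p with ∈-++⁻ P (∈-resp-↭ (↭-sym p) (here refl))
  ... | inj₁ v∈P with ∈-∃++ v∈P
  ...   | P₁ , P₂ , refl with splitting-mask V (P₁ ++ P₂) Q (drop-∷ (↭-trans (↭-sym moved) p))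
    where
    moved : (P₁ ++ v ∷ P₂) ++ Q ↭ v ∷ (P₁ ++ P₂) ++ Q
    moved = begin
      (P₁ ++ v ∷ P₂) ++ Q  ≡⟨ ++-assoc P₁ (v ∷ P₂) Q ⟩
      P₁ ++ v ∷ P₂ ++ Q    ↭⟨ shift v P₁ (P₂ ++ Q) ⟩
      v ∷ P₁ ++ P₂ ++ Q    ≡⟨ cong (v ∷_) (++-assoc P₁ P₂ Q) ⟨
      v ∷ (P₁ ++ P₂) ++ Q  ∎
      where open PermutationReasoning
  ...   | m , len , s , r = true ∷ m , cong suc len , ↭-trans (prep v s) (↭-sym (shift v P₁ P₂)) , r
  splitting-mask (v ∷ V) P Q p | inj₂ v∈Q with ∈-∃++ v∈Q
  ...   | Q₁ , Q₂ , refl with splitting-mask V P (Q₁ ++ Q₂) (drop-∷ (↭-trans (↭-sym moved) p))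
    where
    moved : P ++ Q₁ ++ v ∷ Q₂ ↭ v ∷ P ++ Q₁ ++ Q₂
    moved = begin
      P ++ Q₁ ++ v ∷ Q₂    ≡⟨ ++-assoc P Q₁ (v ∷ Q₂) ⟨
      (P ++ Q₁) ++ v ∷ Q₂  ↭⟨ shift v (P ++ Q₁) Q₂ ⟩
      v ∷ (P ++ Q₁) ++ Q₂  ≡⟨ cong (v ∷_) (++-assoc P Q₁ Q₂) ⟩
      v ∷ P ++ Q₁ ++ Q₂    ∎
      where open PermutationReasoning
  ...   | m , len , s , r = false ∷ m , cong suc len , s , ↭-trans (prep v r) (↭-sym (shift v Q₁ Q₂))

splitting-mask⁺ : ∀ {P Q V : List A} → P ++ Q ↭ V →
                  ∃ λ m → m ∈ masks (length P) (length Q) × select m V ↭ P × reject m V ↭ Q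
splitting-mask⁺ {P = P} {Q} {V} p with splitting-mask V P Q p
... | m , len , s , r = m , subst₂ (λ a b → m ∈ masks a b)
                              (trans (sym (length-select m V len)) (↭-length s))
                              (trans (sym (length-reject m V len)) (↭-length r)) (∈-masks⁺ m) , s , r

Descending : List ℕ → Set
Descending = AllPairs _>_

descending⇒unique : ∀ {xs} → Descending xs → Unique xs
descending⇒unique = AllPairs.map (λ y<x x≡y → <-irrefl (sym x≡y) y<x)

maskPairs : BTree → BTree → List (List Bool × List Bool)
maskPairs l r = cartesianProduct (masks (internals l) (internals r)) (masks (leaves l) (leaves r))

-- The labellings of t, decreasing towards the leaves, that use the cards ws (listed in decreasing
-- order, so that the head goes to the root) on internal nodes and ls on leaves; a pair of masks
-- chooses the cards that go to the left subtree.
mutual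
  labellings : BTree → List ℕ → List ℕ → List LTree
  labellings leaf       []       (b ∷ [])    = tip b ∷ []
  labellings leaf       []       []          = []
  labellings leaf       []       (_ ∷ _ ∷ _) = []
  labellings leaf       (_ ∷ _)  _           = []
  labellings (node l r) []       _           = []
  labellings (node l r) (w ∷ ws) ls          = concatMap (joins w l r ws ls) (maskPairs l r)

  joins : ℕ → BTree → BTree → List ℕ → List ℕ → List Bool × List Bool → List LTree
  joins w l r ws ls (mw , ml) =
    cartesianProductWith (bin w) (labellings l (select mw ws) (select ml ls)) (labellings r (reject mw ws) (reject ml ls))

IsLabelling : BTree → List ℕ → List ℕ → ℕ → LTree → Set
IsLabelling t ws ls c u = shape u ≡ t × DecreasingBelow u c × wCards u ↭ ws × lCards u ↭ ls

∈-joins⁻ : ∀ w l r ws ls mw ml {u} → u ∈ joins w l r ws ls (mw , ml) →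
  ∃₂ λ x y → u ≡ bin w x y × x ∈ labellings l (select mw ws) (select ml ls) ×
             y ∈ labellings r (reject mw ws) (reject ml ls)
∈-joins⁻ w l r ws ls mw ml i
  with ∈-cartesianProductWith⁻ (bin w) (labellings l (select mw ws) (select ml ls))
                                       (labellings r (reject mw ws) (reject ml ls)) i
... | x , y , x∈ , y∈ , refl = x , y , refl , x∈ , y∈

∈-labellings⁻ : ∀ t {ws ls c u} → Descending ws → All (_< c) ws → u ∈ labellings t ws ls → IsLabelling t ws ls c u
∈-labellings⁻ leaf       {[]}     {b ∷ []} _ _ (here refl) = refl , tt , ↭-refl , ↭-refl
∈-labellings⁻ (node l r) {w ∷ ws} {ls} (w>ws ∷ desc) (w<c ∷ _) i
  with find (∈-concatMap⁻ (joins w l r ws ls) {xs = maskPairs l r} i)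
... | (mw , ml) , _ , j with ∈-joins⁻ w l r ws ls mw ml j
... | x , y , refl , x∈ , y∈
  with ∈-labellings⁻ l (AllPairs-select mw desc) (All-select mw w>ws) x∈
     | ∈-labellings⁻ r (AllPairs-reject mw desc) (All-reject mw w>ws) y∈
... | refl , dx , wx , lx | refl , dy , wy , ly =
  refl , (w<c , dx , dy) , prep w (↭-trans (++⁺ wx wy) (select++reject↭ mw ws)) ,
  ↭-trans (++⁺ lx ly) (select++reject↭ ml ls)

↭-greatest-unique : ∀ {b w} R ws → b ∷ R ↭ w ∷ ws → All (_< b) R → All (_< w) ws → b ≡ w
↭-greatest-unique {b} {w} R ws p R<b ws<w with ∈-resp-↭ p (here refl)
... | here b≡w = b≡w
... | there b∈ws with ∈-resp-↭ (↭-sym p) (here refl)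
...   | here w≡b  = sym w≡b
...   | there w∈R = ⊥-elim (<-asym (All.lookup ws<w b∈ws) (All.lookup R<b w∈R))

∈-labellings⁺ : ∀ t {ws ls c u} → Descending ws → IsLabelling t ws ls c u → u ∈ labellings t ws ls
∈-labellings⁺ _ {u = tip b} _ (refl , _ , wp , lp)
  rewrite ↭-empty-inv (↭-sym wp) | ↭-singleton-inv (↭-sym lp) = here refl
∈-labellings⁺ _ {[]}     {u = bin b x y} _ (refl , _ , wp , _) with ↭-length wp
... | ()
∈-labellings⁺ _ {w ∷ ws} {ls} {u = bin b x y} (w>ws ∷ desc) (refl , (_ , dx , dy) , wp , lp)
  with ↭-greatest-unique (wCards x ++ wCards y) ws wp
         (All.++⁺ (decreasingBelow⇒wCards< x dx) (decreasingBelow⇒wCards< y dy)) w>ws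
... | refl with splitting-mask⁺ (drop-∷ wp) | splitting-mask⁺ lp
... | mw , mw∈ , sw , rw | ml , ml∈ , sl , rl =
  ∈-concatMap⁺ (joins b (shape x) (shape y) ws ls) (lose masks∈ (∈-cartesianProductWith⁺ (bin b) x∈ y∈))
  where
  masks∈ : (mw , ml) ∈ maskPairs (shape x) (shape y)
  masks∈ = ∈-cartesianProduct⁺ (subst₂ (λ p q → mw ∈ masks p q) (length-wCards x) (length-wCards y) mw∈)
                               (subst₂ (λ p q → ml ∈ masks p q) (length-lCards x) (length-lCards y) ml∈)
  x∈ : x ∈ labellings (shape x) (select mw ws) (select ml ls)
  x∈ = ∈-labellings⁺ (shape x) (AllPairs-select mw desc) (refl , dx , ↭-sym sw , ↭-sym sl)
  y∈ : y ∈ labellings (shape y) (reject mw ws) (reject ml ls)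
  y∈ = ∈-labellings⁺ (shape y) (AllPairs-reject mw desc) (refl , dy , ↭-sym rw , ↭-sym rl)

bin-injective : ∀ {w x y x′ y′} → bin w x y ≡ bin w x′ y′ → x ≡ x′ × y ≡ y′
bin-injective refl = refl , refl

∈-maskPairs⁻ : ∀ l r {mw ml} → (mw , ml) ∈ maskPairs l r →
               mw ∈ masks (internals l) (internals r) × ml ∈ masks (leaves l) (leaves r)
∈-maskPairs⁻ l r p∈ = ∈-cartesianProduct⁻ (masks (internals l) (internals r)) (masks (leaves l) (leaves r)) p∈

maskPair-lengths : ∀ l r {ws ls : List ℕ} {mw ml} → (mw , ml) ∈ maskPairs l r →
  length ws ≡ internals l + internals r → length ls ≡ leaves l + leaves r →
  (length mw ≡ length ws × length (select mw ws) ≡ internals l × length (reject mw ws) ≡ internals r) ×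
  (length ml ≡ length ls × length (select ml ls) ≡ leaves l × length (reject ml ls) ≡ leaves r)
maskPair-lengths l r {ws} {ls} p∈ lw ll =
  mask-lengths ws (proj₁ (∈-maskPairs⁻ l r p∈)) lw , mask-lengths ls (proj₂ (∈-maskPairs⁻ l r p∈)) ll

labellings-unique : ∀ t {ws ls} → length ws ≡ internals t → length ls ≡ leaves t →
                    Descending ws → Unique ls → Unique (labellings t ws ls)
labellings-unique leaf       {[]}     {_ ∷ []} _ _ _ _ = [] ∷ []
labellings-unique (node l r) {w ∷ ws} {ls} lw ll (w>ws ∷ desc) uls =
  Unique-concatMap⁺ (joins w l r ws ls)
    (Unique.cartesianProduct⁺ (masks-unique (internals l) (internals r)) (masks-unique (leaves l) (leaves r)))
    joins-unique separated
  where
  joins-unique : ∀ {p} → p ∈ maskPairs l r → Unique (joins w l r ws ls p)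
  joins-unique {mw , ml} p∈ with maskPair-lengths l r {ws} {ls} p∈ (suc-injective lw) ll
  ... | (_ , swl , rwl) , (_ , sll , rll) =
    Unique.cartesianProductWith⁺ (bin w) bin-injective
      (labellings-unique l swl sll (AllPairs-select mw desc) (AllPairs-select ml uls))
      (labellings-unique r rwl rll (AllPairs-reject mw desc) (AllPairs-reject ml uls))
  leftCards : ∀ {mw ml z} → z ∈ joins w l r ws ls (mw , ml) →
              ∃₂ λ x y → z ≡ bin w x y × wCards x ↭ select mw ws × lCards x ↭ select ml ls
  leftCards {mw} {ml} z∈ with ∈-joins⁻ w l r ws ls mw ml z∈
  ... | x , y , refl , x∈ , _ with ∈-labellings⁻ l (AllPairs-select mw desc) (All-select mw w>ws) x∈
  ...   | _ , _ , wx , lx = x , y , refl , wx , lx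
  separated : ∀ {p p′ z} → p ∈ maskPairs l r → p′ ∈ maskPairs l r →
              z ∈ joins w l r ws ls p → z ∈ joins w l r ws ls p′ → p ≡ p′
  separated {mw , ml} {mw′ , ml′} p∈ p′∈ z∈ z∈′
    with leftCards {mw} {ml} z∈ | leftCards {mw′} {ml′} z∈′
       | maskPair-lengths l r {ws} {ls} p∈ (suc-injective lw) ll | maskPair-lengths l r {ws} {ls} p′∈ (suc-injective lw) ll
  ... | x , _ , refl , wx , lx | _ , _ , eq , wx′ , lx′ | (lmw , _) , (lml , _) | (lmw′ , _) , (lml′ , _)
    with bin-injective eq
  ... | refl , _ = cong₂ _,_
    (select-injective mw mw′ ws (descending⇒unique desc) lmw lmw′ (↭-trans (↭-sym wx) wx′))
    (select-injective ml ml′ ls uls lml lml′ (↭-trans (↭-sym lx) lx′))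

count : BTree → ℕ
count leaf       = 1
count (node l r) = length (maskPairs l r) * (count l * count r)

length-labellings : ∀ t {ws ls} → length ws ≡ internals t → length ls ≡ leaves t → length (labellings t ws ls) ≡ count t
length-labellings leaf       {[]}     {_ ∷ []} _  _  = refl
length-labellings (node l r) {w ∷ ws} {ls}     lw ll =
  length-concatMap-const (joins w l r ws ls) (maskPairs l r) length-joins
  where
  length-joins : ∀ {p} → p ∈ maskPairs l r → length (joins w l r ws ls p) ≡ count l * count r
  length-joins {mw , ml} p∈ with maskPair-lengths l r {ws} {ls} p∈ (suc-injective lw) ll
  ... | (_ , swl , rwl) , (_ , sll , rll) =
    trans (length-cartesianProductWith (bin w) (labellings l (select mw ws) (select ml ls))
                                               (labellings r (reject mw ws) (reject ml ls)))
          (cong₂ _*_ (length-labellings l swl sll) (length-labellings r rwl rll))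

-- Hook lengths

sizes-++ : ∀ xs ys → sizes (xs ++ ys) ≡ sizes xs + sizes ys
sizes-++ []       ys = refl
sizes-++ (x ∷ xs) ys = trans (cong (size x +_) (sizes-++ xs ys)) (sym (+-assoc (size x) (sizes xs) (sizes ys)))

hookProducts-++ : ∀ xs ys → hookProducts (xs ++ ys) ≡ hookProducts xs * hookProducts ys
hookProducts-++ []       ys = sym (+-identityʳ (hookProducts ys))
hookProducts-++ (x ∷ xs) ys =
  trans (cong (hookProduct x *_) (hookProducts-++ xs ys)) (sym (*-assoc (hookProduct x) (hookProducts xs) (hookProducts ys)))

sizes-wNodes : ∀ t → sizes (wNodes t) ≡ internals t
sizes-wNodes leaf       = refl
sizes-wNodes (node l r) =
  trans (+-identityʳ _) (cong suc (trans (sizes-++ (wNodes l) (wNodes r)) (cong₂ _+_ (sizes-wNodes l) (sizes-wNodes r))))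

count-hookProducts : ∀ t → count t * hookProducts (wNodes t) ≡ internals t ! * leaves t !
count-hookProducts leaf       = refl
count-hookProducts (node l r) = begin
  count (node l r) * hookProducts (wNodes (node l r))
    ≡⟨ cong₂ (λ M h → M * (cₗ * cᵣ) * h)
         (length-cartesianProductWith _,_ (masks iₗ iᵣ) (masks lₗ lᵣ))
         (cong₂ (λ i h → suc i * h * 1)
           (trans (sizes-++ (wNodes l) (wNodes r)) (cong₂ _+_ (sizes-wNodes l) (sizes-wNodes r)))
           (hookProducts-++ (wNodes l) (wNodes r))) ⟩
  (Mᵢ * Mₗ) * (cₗ * cᵣ) * (suc (iₗ + iᵣ) * (hₗ * hᵣ) * 1)
    ≡⟨ regroup₁ (suc (iₗ + iᵣ)) Mᵢ Mₗ cₗ cᵣ hₗ hᵣ ⟩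
  suc (iₗ + iᵣ) * ((Mᵢ * Mₗ) * ((cₗ * hₗ) * (cᵣ * hᵣ)))
    ≡⟨ cong₂ (λ p q → suc (iₗ + iᵣ) * ((Mᵢ * Mₗ) * (p * q))) (count-hookProducts l) (count-hookProducts r) ⟩
  suc (iₗ + iᵣ) * ((Mᵢ * Mₗ) * ((iₗ ! * lₗ !) * (iᵣ ! * lᵣ !)))
    ≡⟨ regroup₂ (suc (iₗ + iᵣ)) Mᵢ Mₗ (iₗ !) (iᵣ !) (lₗ !) (lᵣ !) ⟩
  suc (iₗ + iᵣ) * ((Mᵢ * (iₗ ! * iᵣ !)) * (Mₗ * (lₗ ! * lᵣ !)))
    ≡⟨ cong₂ (λ p q → suc (iₗ + iᵣ) * (p * q)) (length-masks iₗ iᵣ) (length-masks lₗ lᵣ) ⟩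
  suc (iₗ + iᵣ) * ((iₗ + iᵣ) ! * (lₗ + lᵣ) !)
    ≡⟨ *-assoc (suc (iₗ + iᵣ)) ((iₗ + iᵣ) !) ((lₗ + lᵣ) !) ⟨
  suc (iₗ + iᵣ) ! * (lₗ + lᵣ) !  ∎
  where
  open ≡-Reasoning
  iₗ iᵣ lₗ lᵣ cₗ cᵣ hₗ hᵣ Mᵢ Mₗ : ℕ
  iₗ = internals l
  iᵣ = internals r
  lₗ = leaves l
  lᵣ = leaves r
  cₗ = count l
  cᵣ = count r
  hₗ = hookProducts (wNodes l)
  hᵣ = hookProducts (wNodes r)
  Mᵢ = length (masks iₗ iᵣ)
  Mₗ = length (masks lₗ lᵣ)
  regroup₁ : ∀ s x y c d g h → (x * y) * (c * d) * (s * (g * h) * 1) ≡ s * ((x * y) * ((c * g) * (d * h)))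
  regroup₁ = solve-∀
  regroup₂ : ∀ s x y a b c d → s * ((x * y) * ((a * c) * (b * d))) ≡ s * ((x * (a * b)) * (y * (c * d)))
  regroup₂ = solve-∀

count-hookProduct : ∀ t → count t * hookProduct (bottomTree t) ≡ (leaves t !) ^ 2
count-hookProduct t = begin
  count t * (suc (sizes (wNodes t)) * hookProducts (wNodes t))
    ≡⟨ cong (λ i → count t * (suc i * hookProducts (wNodes t))) (sizes-wNodes t) ⟩
  count t * (suc (internals t) * hookProducts (wNodes t))
    ≡⟨ x∙yz≈y∙xz (count t) (suc (internals t)) (hookProducts (wNodes t)) ⟩
  suc (internals t) * (count t * hookProducts (wNodes t))
    ≡⟨ cong (suc (internals t) *_) (count-hookProducts t) ⟩
  suc (internals t) * (internals t ! * leaves t !)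
    ≡⟨ *-assoc (suc (internals t)) (internals t !) (leaves t !) ⟨
  suc (internals t) ! * leaves t !
    ≡⟨ cong (λ n → n ! * leaves t !) (leaves≡suc-internals t) ⟨
  leaves t ! * leaves t !
    ≡⟨ cong (leaves t ! *_) (*-identityʳ (leaves t !)) ⟨
  (leaves t !) ^ 2  ∎
  where
  open ≡-Reasoning

below : ℕ → List ℕ
below = applyDownFrom suc

above : ℕ → List ℕ
above k = applyDownFrom (λ i → suc (i + k)) k

∈-below⇒≤ : ∀ {n z} → z ∈ below n → z ≤ n
∈-below⇒≤ z∈ with ∈-applyDownFrom⁻ suc z∈
... | _ , i<n , refl = i<n

below-descending : ∀ n → Descending (below n)
below-descending n = AllPairs.applyDownFrom⁺₁ suc n (λ j<i _ → s≤s j<i)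

above-descending : ∀ k → Descending (above k)
above-descending k = AllPairs.applyDownFrom⁺₁ _ k (λ j<i _ → s≤s (+-monoˡ-< k j<i))

above> : ∀ k → All (k <_) (above k)
above> k = All.applyDownFrom⁺₂ _ k (λ i → s≤s (m≤n+m k i))

below-+ : ∀ m n → below (m + n) ≡ applyDownFrom (λ i → suc (i + n)) m ++ below n
below-+ zero    n = refl
below-+ (suc m) n = cong (suc (m + n) ∷_) (below-+ m n)

below-double : ∀ k′ → below (2 * suc k′) ≡ above (suc k′) ++ suc k′ ∷ below k′
below-double k′ = trans (cong (λ n → below (suc k′ + n)) (+-identityʳ (suc k′))) (below-+ (suc k′) (suc k′))

below-double↭ : ∀ k′ → below (2 * suc k′) ↭ suc k′ ∷ below k′ ++ above (suc k′)
below-double↭ k′ = begin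
  below (2 * suc k′)                      ≡⟨ below-double k′ ⟩
  above (suc k′) ++ suc k′ ∷ below k′     ↭⟨ shift (suc k′) (above (suc k′)) (below k′) ⟩
  suc k′ ∷ above (suc k′) ++ below k′     ↭⟨ prep (suc k′) (++-comm (above (suc k′)) (below k′)) ⟩
  suc k′ ∷ below k′ ++ above (suc k′)     ∎
  where open PermutationReasoning

upTo↭below : ∀ n → applyUpTo suc n ↭ below n
upTo↭below n = ↭-trans (↭-sym (↭-reverse (applyUpTo suc n))) (↭-reflexive (reverse-applyUpTo suc n))

length-filter<-below : ∀ n a → a ≤ suc n → length (filter (_<? a) (below n)) ≡ a ∸ 1
length-filter<-below zero    zero       _         = refl
length-filter<-below zero    (suc zero) _         = refl
length-filter<-below zero    (suc (suc a)) (s≤s ())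
length-filter<-below (suc n) a          a≤2+n with suc n <? a
... | yes n<a rewrite filter-accept (_<? a) {xs = below n} n<a = begin
  suc (length (filter (_<? a) (below n)))  ≡⟨ cong (suc ∘ length) (filter-all (_<? a) below<a) ⟩
  suc (length (below n))                   ≡⟨ cong suc (length-applyDownFrom suc n) ⟩
  suc n                                    ≡⟨ cong (_∸ 1) (≤-antisym n<a a≤2+n) ⟩
  a ∸ 1                                    ∎
  where
  open ≡-Reasoning
  below<a : All (_< a) (below n)
  below<a = All.tabulate (λ z∈ → ≤-<-trans (∈-below⇒≤ z∈) (<-trans (n<1+n n) n<a))
... | no n≮a rewrite filter-reject (_<? a) {xs = below n} n≮a = length-filter<-below n a (≮⇒≥ n≮a)

-- Exactly a − 1 of the cards 1, …, 2k lie below a, and these are the cards of ws.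
firstCard-forced : ∀ k′ {a ws ls} → a ∷ ws ++ ls ↭ below (2 * suc k′) → All (_< a) ws → All (a ≤_) ls →
                   length ws ≡ k′ → a ≡ suc k′ × ws ↭ below k′ × ls ↭ above (suc k′)
firstCard-forced k′ {a} {ws} {ls} p ws<a a≤ls len with a≡k
  where
  ws↭ : ws ↭ filter (_<? a) (below (2 * suc k′))
  ws↭ = ↭-trans (↭-reflexive (sym (trans (filter-reject (_<? a) (<-irrefl refl))
                                         (filter-keepˡ (_<? a) ws<a (All.map ≤⇒≯ a≤ls)))))
                (filter-↭ (_<? a) p)
  a≡k : a ≡ suc k′
  a≡k with ∈-applyDownFrom⁻ suc (∈-resp-↭ p (here refl))
  ... | i , a≤2k , refl = cong suc (begin
    i                                                 ≡⟨ length-filter<-below (2 * suc k′) a (m≤n⇒m≤1+n a≤2k) ⟨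
    length (filter (_<? a) (below (2 * suc k′)))       ≡⟨ ↭-length ws↭ ⟨
    length ws                                          ≡⟨ len ⟩
    k′                                                 ∎)
    where open ≡-Reasoning
... | refl = refl , ↭-partition (_<? suc k′) ws<a (All.map ≤⇒≯ a≤ls) below<k (All.map <⇒≯ (above> (suc k′))) rest
  where
  below<k : All (_< suc k′) (below k′)
  below<k = All.tabulate (λ z∈ → s≤s (∈-below⇒≤ z∈))
  rest : ws ++ ls ↭ below k′ ++ above (suc k′)
  rest = drop-∷ (↭-trans p (below-double↭ k′))

internals-from-length : ∀ t k′ → length (levelOrder t) ≡ 2 * suc k′ ∸ 1 → internals t ≡ k′
internals-from-length t k′ e = *-cancelˡ-≡ (internals t) k′ 2 (suc-injective (begin
  suc (2 * internals t)              ≡⟨ odd (internals t) ⟨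
  internals t + suc (internals t)    ≡⟨ cong (internals t +_) (leaves≡suc-internals t) ⟨
  internals t + leaves t             ≡⟨ length-levelOrder t ⟨
  length (levelOrder t)              ≡⟨ e ⟩
  2 * suc k′ ∸ 1                     ≡⟨ +-suc k′ (k′ + 0) ⟩
  suc (2 * k′)                       ∎))
  where
  open ≡-Reasoning
  odd : ∀ n → n + suc n ≡ suc (2 * n)
  odd n = trans (cong (λ m → n + suc m) (sym (+-identityʳ n))) (+-suc n (n + 0))

followers : BTree → ℕ → List (List ℕ)
followers t k′ = map ((suc k′ ∷_) ∘ bobCards) (labellings t (below k′) (above (suc k′)))

module _ (t : BTree) (k′ : ℕ) (internals≡ : internals t ≡ k′) where

  private
    length-below : length (below k′) ≡ internals t
    length-below = trans (length-applyDownFrom suc k′) (sym internals≡)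

    length-above : length (above (suc k′)) ≡ leaves t
    length-above = trans (length-applyDownFrom _ (suc k′)) (trans (cong suc (sym internals≡)) (sym (leaves≡suc-internals t)))

    below<k : All (_< suc k′) (below k′)
    below<k = All.tabulate (λ z∈ → s≤s (∈-below⇒≤ z∈))

  length-followers : length (followers t k′) ≡ count t
  length-followers = trans (length-map _ (labellings t (below k′) (above (suc k′))))
                           (length-labellings t length-below length-above)

  followers-unique : Unique (followers t k′)
  followers-unique = Unique-map⁺-on ((suc k′ ∷_) ∘ bobCards) sameCards
    (labellings-unique t length-below length-above (below-descending k′) (descending⇒unique (above-descending (suc k′))))
    where
    sameCards : ∀ {u v} → u ∈ labellings t (below k′) (above (suc k′)) →
                v ∈ labellings t (below k′) (above (suc k′)) →
                suc k′ ∷ bobCards u ≡ suc k′ ∷ bobCards v → u ≡ v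
    sameCards u∈ v∈ eq = bobCards-injective _ _
      (trans (proj₁ (∈-labellings⁻ t (below-descending k′) below<k u∈))
             (sym (proj₁ (∈-labellings⁻ t (below-descending k′) below<k v∈))))
      (∷-injectiveʳ eq)

  ∈-followers⇔ : ∀ xs → xs ∈ followers t k′ ⇔ (IsInitialState (2 * suc k′) xs × NecessarilyFollows (levelOrder t) xs)
  ∈-followers⇔ xs = mk⇔ (to xs) (from xs)
    where
    to : ∀ xs → xs ∈ followers t k′ → IsInitialState (2 * suc k′) xs × NecessarilyFollows (levelOrder t) xs
    to xs xs∈ with ∈-map⁻ _ xs∈
    ... | u , u∈ , refl with ∈-labellings⁻ t (below-descending k′) below<k u∈
    ... | refl , d , wp , lp =
      initial , Equivalence.from (necessarilyFollows⇔consistent u (suc k′))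
                  (Equivalence.from (consistent⇔decreasing u (suc k′))
                    (d , All-resp-↭ (↭-sym lp) (All.map <⇒≤ (above> (suc k′)))))
      where
      initial : suc k′ ∷ bobCards u ↭ applyUpTo suc (2 * suc k′)
      initial = begin
        suc k′ ∷ bobCards u                  ↭⟨ prep (suc k′) (bobCards↭ u) ⟩
        suc k′ ∷ wCards u ++ lCards u        ↭⟨ prep (suc k′) (++⁺ wp lp) ⟩
        suc k′ ∷ below k′ ++ above (suc k′)  ↭⟨ below-double↭ k′ ⟨
        below (2 * suc k′)                   ↭⟨ upTo↭below (2 * suc k′) ⟨
        applyUpTo suc (2 * suc k′)           ∎
        where open PermutationReasoning
    from : ∀ xs → IsInitialState (2 * suc k′) xs × NecessarilyFollows (levelOrder t) xs → xs ∈ followers t k′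
    from []       (_ , ())
    from (a ∷ bs) (perm , nf) with bobCards-surjective t bs lengthBob
      where
      lengthBob : length bs ≡ length (levelOrder t)
      lengthBob = begin
        length bs                   ≡⟨ suc-injective (trans (↭-length perm) (length-applyUpTo suc (2 * suc k′))) ⟩
        k′ + suc (k′ + 0)           ≡⟨ cong₂ (λ m n → m + suc n) (sym internals≡)
                                             (trans (+-identityʳ k′) (sym internals≡)) ⟩
        internals t + suc (internals t) ≡⟨ cong (internals t +_) (leaves≡suc-internals t) ⟨
        internals t + leaves t      ≡⟨ length-levelOrder t ⟨
        length (levelOrder t)       ∎
        where open ≡-Reasoning
    ... | u , refl , refl
      with Equivalence.to (consistent⇔decreasing u a) (Equivalence.to (necessarilyFollows⇔consistent u a) nf)
    ... | d , a≤l
      with firstCard-forced k′ (↭-trans (prep a (↭-sym (bobCards↭ u))) (↭-trans perm (upTo↭below (2 * suc k′))))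
                         (decreasingBelow⇒wCards< u d) a≤l (trans (length-wCards u) internals≡)
    ... | refl , wp , lp = ∈-map⁺ _ (∈-labellings⁺ (shape u) (below-descending k′) (refl , d , wp , lp))

-- The win-loss property and the letter counts of s already follow from s being the level order of t.
theorem7p1 : (k : ℕ) → 1 ≤ k →
    (s : List Letter) → IsWinLossSequence s → length s ≡ 2 * k ∸ 1 →
    occ L s ≡ k → occ W s ≡ k ∸ 1 →
    (t : BTree) → levelOrder t ≡ s →
    (states : List (List ℕ)) → Unique states →
    ((xs : List ℕ) → (xs ∈ states) ⇔ (IsInitialState (2 * k) xs × NecessarilyFollows s xs)) →
    length states * hookProduct (bottomTree t) ≡ (k !) ^ 2
theorem7p1 (suc k′) _ _ _ length-s _ _ t refl states states-unique states⇔ = begin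
  length states * hookProduct (bottomTree t)  ≡⟨ cong (_* hookProduct (bottomTree t)) length-states ⟩
  count t * hookProduct (bottomTree t)        ≡⟨ count-hookProduct t ⟩
  (leaves t !) ^ 2                            ≡⟨ cong (λ n → (n !) ^ 2) leaves≡ ⟩
  (suc k′ !) ^ 2                              ∎
  where
  open ≡-Reasoning
  internals≡ : internals t ≡ k′
  internals≡ = internals-from-length t k′ length-s
  leaves≡ : leaves t ≡ suc k′
  leaves≡ = trans (leaves≡suc-internals t) (cong suc internals≡)
  length-states : length states ≡ count t
  length-states = trans
    (sameMembers⇒length≡ states-unique (followers-unique t k′ internals≡)
      (λ {xs} → ⇔-trans (states⇔ xs) (⇔-sym (∈-followers⇔ t k′ internals≡ xs))))
    (length-followers t k′ internals≡)
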